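{- Let $p$ be an odd prime, $a,m\in\mathbb Z_p$ with $a\not\equiv 0,-1\pmod p$ and $m\not\equiv 0\pmod p$. Put $c_k=\binom ak\binom{ -1-a}k\binom{2k}k$. Then $$\frac{m-4}2\sum_{k=0}^{p-1}\frac{k^2c_k}{m^k}\equiv\sum_{k=0}^{p-1}\frac{kc_k}{m^k}-2a(a+1)\sum_{k=0}^{p-1}\frac{c_k}{m^k}+a(a+1)\sum_{k=0}^{p-2}\frac{c_k}{m^k(k+1)}\pmod{p^3},$$ $$\frac{m-4}2\sum_{k=0}^{p-1}\frac{k^3c_k}{m^k}\equiv 3\sum_{k=0}^{p-1}\frac{k^2c_k}{m^k}-(2a(a+1)-1)\sum_{k=0}^{p-1}\frac{kc_k}{m^k}-a(a+1)\sum_{k=0}^{p-1}\frac{c_k}{m^k}\pmod{p^3}.$$ Consequently, if moreover $m\not\equiv 4\pmod p$, then $$\sum_{k=0}^{p-1}\frac{k^3c_k}{m^k}\equiv\frac{(2-4a(a+1))(m-4)+12}{(m-4)^2}\sum_{k=0}^{p-1}\frac{kc_k}{m^k}-\frac{2a(a+1)(m+8)}{(m-4)^2}\sum_{k=0}^{p-1}\frac{c_k}{m^k}+\frac{12a(a+1)}{(m-4)^2}\sum_{k=0}^{p-2}\frac{c_k}{m^k(k+1)}\pmod{p^3}.$$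
   Context: $\mathbb Z_p$ denotes the ring of rational numbers whose denominators are not divisible by $p$; congruences are in $\mathbb Z_p$. Generalized binomial coefficients: $\binom a0=1$, $\binom ak=\frac{a(a-1)\cdots(a-k+1)}{k!}$ for $k\ge1$. -}

module Defs where

open import Data.Nat as ℕ using (ℕ; zero; suc; _!)
open import Data.Nat.Divisibility using (_∣_)
open import Data.Nat.Combinatorics using (_C_)
open import Data.Integer as ℤ using (ℤ; +_)
open import Data.Rational as ℚ using (ℚ; 0ℚ; 1ℚ; _+_; _*_; _-_; -_; 1/_; ≢-nonZero)
open import Data.Rational.Properties using (_≟_)
open import Relation.Nullary using (¬_; yes; no)

fromℕ : ℕ → ℚ
fromℕ n = + n ℚ./ 1

-- total inverse (only ever applied to nonzero arguments in the theorem)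
inv : ℚ → ℚ
inv q with q ≟ 0ℚ
... | yes _ = 0ℚ
... | no q≢0 = 1/_ q {{≢-nonZero q≢0}}

infixl 7 _÷'_
_÷'_ : ℚ → ℚ → ℚ
x ÷' y = x * inv y

infixr 8 _^'_
_^'_ : ℚ → ℕ → ℚ
x ^' zero = 1ℚ
x ^' suc n = (x ^' n) * x

falling : ℚ → ℕ → ℚ
falling a zero = 1ℚ
falling a (suc k) = falling a k * (a - fromℕ k)

binom : ℚ → ℕ → ℚ
binom a k = falling a k ÷' fromℕ (k !)

sumTo : ℕ → (ℕ → ℚ) → ℚ
sumTo zero f = 0ℚ
sumTo (suc n) f = sumTo n f + f n

InZp : ℕ → ℚ → Set
InZp p q = ¬ (p ∣ ℚ.denominatorℕ q)

-- x ≡ y (mod p^e) in Z_p: x - y ∈ p^e Z_p, i.e. p^e divides the reduced numerator of x - y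
-- (then the reduced denominator is automatically prime to p)
CongMod : ℕ → ℕ → ℚ → ℚ → Set
CongMod p e x y = (p ℕ.^ e) ∣ ℤ.∣ ℚ.numerator (x - y) ∣

c : ℚ → ℕ → ℚ
c a k = binom a k * binom (- 1ℚ - a) k * fromℕ ((2 ℕ.* k) C k)

{-# OPTIONS --safe #-}
module Submission where

-- Put u k = c_k / m^k and A = a(a+1). Since c_{k+1}/c_k = 2(2k+1)(k-a)(k+1+a)/(k+1)³, the terms satisfy
-- m (k+1)³ u (k+1) = 2(2k+1)(k(k+1) - A) u k, which makes two combinations of the sums over k < n telescope:
--   (m-4) Σ k² u k - 2 Σ k u k + 4A Σ u k - 2A Σ u k/(k+1) = - m n² u n,
--   (m-4) Σ k³ u k - 6 Σ k² u k - (2-4A) Σ k u k + 2A Σ u k = - m n³ u n.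
-- With n = p - 1, the first two congruences differ from these identities by p-integral multiples of
-- u (p-1), and p³ divides c_{p-1}: if a ≡ r (mod p) then 0 < r < p - 1 by hypothesis, so the factor a - r
-- of binom a (p-1) and the factor -1-a-(p-1-r) of binom (-1-a) (p-1) are divisible by p, as is
-- binom (2p-2) (p-1). The third congruence is a combination of the first two once m - 4 is invertible.

open import Defs
open import Level using (0ℓ)
open import Data.Nat as ℕ using (ℕ; zero; suc; _∸_; _!; _<_; _≤_)
import Data.Nat.Properties as ℕP
open import Data.Nat.Divisibility as ℕD using (_∣_; divides; divides-refl)
open import Data.Nat.Combinatorics using (_C_; nCk≡n!/k![n-k]!; k![n∸k]!∣n!)
open import Data.Nat.DivMod using (m/n*n≡m)
open import Data.Nat.Primality using (Prime; euclidsLemma; prime⇒irreducible; prime⇒nonZero; prime⇒nonTrivial; ¬prime[0]; ¬prime[1])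
open import Data.Nat.Coprimality using (Coprime; coprime-Bézout)
open import Data.Nat.GCD using (module Bézout)
import Data.Nat.Tactic.RingSolver as ℕSolver
open import Data.Integer as ℤ using (ℤ; +_)
import Data.Integer.Properties as ℤP
open import Data.Integer.DivMod using (_%ℕ_; _/ℕ_; n%ℕd<d; a≡a%ℕn+[a/ℕn]*n)
import Data.Integer.Tactic.RingSolver as ℤSolver
open import Data.Rational as ℚ using (ℚ; 0ℚ; 1ℚ; _+_; _*_; _-_; -_; ↥_; ↧_; ≢-nonZero)
open import Data.Rational.Properties using (*-assoc; neg-distribˡ-*; +-inverseʳ; +-identityʳ; +-*-commutativeRing; _≟_; *-inverseʳ; *-identityˡ; *-identityʳ; *-zeroˡ; *-zeroʳ; toℚᵘ-injective; toℚᵘ-fromℚᵘ; toℚᵘ-homo-+; toℚᵘ-homo-*)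
import Data.Rational.Unnormalised as ℚᵘ
import Data.Rational.Unnormalised.Properties as ℚᵘP
open import Data.Product using (Σ-syntax; _×_; _,_)
open import Data.Sum using (inj₁; inj₂)
open import Data.List using (_∷_; [])
open import Relation.Nullary using (¬_; Dec; yes; no; contradiction)
open import Relation.Nullary.Decidable.Core using (dec⇒maybe)
open import Relation.Binary.PropositionalEquality
open import Tactic.RingSolver.Core.AlmostCommutativeRing using (AlmostCommutativeRing; fromCommutativeRing)
open import Tactic.RingSolver using (solve-∀; solve)

ℚ-ring : AlmostCommutativeRing 0ℓ 0ℓ
ℚ-ring = fromCommutativeRing +-*-commutativeRing (λ x → dec⇒maybe (0ℚ ≟ x))

fromℤ : ℤ → ℚ
fromℤ N = N ℚ./ 1

private
  toℚᵘ-fromℤ : ∀ N → ℚ.toℚᵘ (fromℤ N) ℚᵘ.≃ ℚᵘ.mkℚᵘ N 0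
  toℚᵘ-fromℤ N = toℚᵘ-fromℚᵘ (ℚᵘ.mkℚᵘ N 0)

fromℤ-+ : ∀ M N → fromℤ (M ℤ.+ N) ≡ fromℤ M + fromℤ N
fromℤ-+ M N = toℚᵘ-injective (begin
  ℚ.toℚᵘ (fromℤ (M ℤ.+ N))                   ≈⟨ toℚᵘ-fromℤ (M ℤ.+ N) ⟩
  ℚᵘ.mkℚᵘ (M ℤ.+ N) 0                         ≈⟨ ℚᵘ.*≡* (unit-denominators M N) ⟩
  ℚᵘ.mkℚᵘ M 0 ℚᵘ.+ ℚᵘ.mkℚᵘ N 0               ≈⟨ ℚᵘP.+-cong (toℚᵘ-fromℤ M) (toℚᵘ-fromℤ N) ⟨
  ℚ.toℚᵘ (fromℤ M) ℚᵘ.+ ℚ.toℚᵘ (fromℤ N)     ≈⟨ toℚᵘ-homo-+ (fromℤ M) (fromℤ N) ⟨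
  ℚ.toℚᵘ (fromℤ M + fromℤ N)                 ∎)
  where
  open ℚᵘP.≃-Reasoning
  unit-denominators : ∀ M N → (M ℤ.+ N) ℤ.* + 1 ≡ (M ℤ.* + 1 ℤ.+ N ℤ.* + 1) ℤ.* + 1
  unit-denominators = ℤSolver.solve-∀

fromℤ-* : ∀ M N → fromℤ (M ℤ.* N) ≡ fromℤ M * fromℤ N
fromℤ-* M N = toℚᵘ-injective (begin
  ℚ.toℚᵘ (fromℤ (M ℤ.* N))                   ≈⟨ toℚᵘ-fromℤ (M ℤ.* N) ⟩
  ℚᵘ.mkℚᵘ (M ℤ.* N) 0                         ≈⟨ ℚᵘ.*≡* refl ⟩
  ℚᵘ.mkℚᵘ M 0 ℚᵘ.* ℚᵘ.mkℚᵘ N 0               ≈⟨ ℚᵘP.*-cong (toℚᵘ-fromℤ M) (toℚᵘ-fromℤ N) ⟨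
  ℚ.toℚᵘ (fromℤ M) ℚᵘ.* ℚ.toℚᵘ (fromℤ N)     ≈⟨ toℚᵘ-homo-* (fromℤ M) (fromℤ N) ⟨
  ℚ.toℚᵘ (fromℤ M * fromℤ N)                 ∎)
  where open ℚᵘP.≃-Reasoning

fromℤ-neg : ∀ N → fromℤ (ℤ.- N) ≡ - fromℤ N
fromℤ-neg N = begin
  fromℤ (ℤ.- N)              ≡⟨ cong fromℤ (ℤP.-1*i≡-i N) ⟨
  fromℤ (ℤ.-1ℤ ℤ.* N)        ≡⟨ fromℤ-* ℤ.-1ℤ N ⟩
  - 1ℚ * fromℤ N             ≡⟨ neg-distribˡ-* 1ℚ (fromℤ N) ⟨
  - (1ℚ * fromℤ N)           ≡⟨ cong -_ (*-identityˡ (fromℤ N)) ⟩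
  - fromℤ N                  ∎
  where open ≡-Reasoning

fromℤ-injective : ∀ {M N} → fromℤ M ≡ fromℤ N → M ≡ N
fromℤ-injective {M} {N} eq with ℚᵘP.≃-trans (ℚᵘP.≃-sym (toℚᵘ-fromℤ M))
                                  (ℚᵘP.≃-trans (ℚᵘP.≃-reflexive (cong ℚ.toℚᵘ eq)) (toℚᵘ-fromℤ N))
... | ℚᵘ.*≡* M*1≡N*1 = trans (sym (ℤP.*-identityʳ M)) (trans M*1≡N*1 (ℤP.*-identityʳ N))

fromℕ-+ : ∀ m n → fromℕ (m ℕ.+ n) ≡ fromℕ m + fromℕ n
fromℕ-+ m n = trans (cong fromℤ (ℤP.pos-+ m n)) (fromℤ-+ (+ m) (+ n))

fromℕ-* : ∀ m n → fromℕ (m ℕ.* n) ≡ fromℕ m * fromℕ n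
fromℕ-* m n = trans (cong fromℤ (ℤP.pos-* m n)) (fromℤ-* (+ m) (+ n))

fromℕ-suc : ∀ n → fromℕ (suc n) ≡ fromℕ n + 1ℚ
fromℕ-suc n = trans (cong fromℕ (ℕP.+-comm 1 n)) (fromℕ-+ n 1)

fromℕ+1≢0 : ∀ n → fromℕ n + 1ℚ ≢ 0ℚ
fromℕ+1≢0 n eq with fromℤ-injective {+ suc n} {+ 0} (trans (fromℕ-suc n) eq)
... | ()

numerator-denominator : ∀ x → x * fromℤ (↧ x) ≡ fromℤ (↥ x)
numerator-denominator x@(ℚ.mkℚ n d _) = toℚᵘ-injective (begin
  ℚ.toℚᵘ (x * fromℤ (↧ x))                 ≈⟨ toℚᵘ-homo-* x (fromℤ (↧ x)) ⟩
  ℚ.toℚᵘ x ℚᵘ.* ℚ.toℚᵘ (fromℤ (↧ x))      ≈⟨ ℚᵘP.*-congˡ {ℚ.toℚᵘ x} (toℚᵘ-fromℤ (↧ x)) ⟩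
  ℚ.toℚᵘ x ℚᵘ.* ℚᵘ.mkℚᵘ (↧ x) 0           ≈⟨ ℚᵘ.*≡* (trans (ℤP.*-identityʳ _) (cong (n ℤ.*_) (cong +_ (sym (ℕP.*-identityʳ (suc d)))))) ⟩
  ℚᵘ.mkℚᵘ (↥ x) 0                          ≈⟨ toℚᵘ-fromℤ (↥ x) ⟨
  ℚ.toℚᵘ (fromℤ (↥ x))                     ∎)
  where open ℚᵘP.≃-Reasoning

*-inv : ∀ {x} → x ≢ 0ℚ → x * inv x ≡ 1ℚ
*-inv {x} x≢0 with x ≟ 0ℚ
... | yes x≡0 = contradiction x≡0 x≢0
... | no x≢0′ = *-inverseʳ x {{≢-nonZero x≢0′}}

inv-unique : ∀ {x y} → x * y ≡ 1ℚ → inv x ≡ y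
inv-unique {x} {y} xy≡1 = begin
  inv x                ≡⟨ *-identityʳ (inv x) ⟨
  inv x * 1ℚ           ≡⟨ cong (inv x *_) xy≡1 ⟨
  inv x * (x * y)      ≡⟨ regroup x y (inv x) ⟩
  (x * inv x) * y      ≡⟨ cong (_* y) (*-inv x≢0) ⟩
  1ℚ * y               ≡⟨ *-identityˡ y ⟩
  y                    ∎
  where
  open ≡-Reasoning
  regroup : ∀ x y i → i * (x * y) ≡ (x * i) * y
  regroup = solve-∀ ℚ-ring
  x≢0 : x ≢ 0ℚ
  x≢0 refl with trans (sym (*-zeroˡ y)) xy≡1
  ... | ()

inv-* : ∀ x y → inv (x * y) ≡ inv x * inv y
-- Testing 0ℚ ≟ x rather than x ≟ 0ℚ keeps `with` from abstracting the test inside inv.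
inv-* x y with 0ℚ ≟ x | 0ℚ ≟ y
... | yes refl | _ = trans (cong inv (*-zeroˡ y)) (sym (*-zeroˡ (inv y)))
... | no _ | yes refl = trans (cong inv (*-zeroʳ x)) (sym (*-zeroʳ (inv x)))
... | no 0≢x | no 0≢y = inv-unique {x * y} (begin
  (x * y) * (inv x * inv y)      ≡⟨ interchange x y (inv x) (inv y) ⟩
  (x * inv x) * (y * inv y)      ≡⟨ cong₂ _*_ (*-inv (≢-sym 0≢x)) (*-inv (≢-sym 0≢y)) ⟩
  1ℚ                             ∎)
  where
  open ≡-Reasoning
  interchange : ∀ x y i j → (x * y) * (i * j) ≡ (x * i) * (y * j)
  interchange = solve-∀ ℚ-ring

-- The recurrence of c

binom-suc : ∀ x k → binom x (suc k) * (fromℕ k + 1ℚ) ≡ binom x k * (x - fromℕ k)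
binom-suc x k = begin
  falling x k * (x - K) * inv (fromℕ (suc k ℕ.* k !)) * (K + 1ℚ) ≡⟨ cong (λ z → falling x k * (x - K) * z * (K + 1ℚ)) inv-fact ⟩
  falling x k * (x - K) * (inv (K + 1ℚ) * inv F) * (K + 1ℚ)     ≡⟨ regroup (falling x k) (x - K) (K + 1ℚ) (inv (K + 1ℚ)) (inv F) ⟩
  falling x k * inv F * (x - K) * ((K + 1ℚ) * inv (K + 1ℚ))     ≡⟨ cong (binom x k * (x - K) *_) (*-inv (fromℕ+1≢0 k)) ⟩
  binom x k * (x - K) * 1ℚ                                      ≡⟨ *-identityʳ _ ⟩
  binom x k * (x - K)                                           ∎
  where
  open ≡-Reasoning
  K : ℚ
  K = fromℕ k
  F : ℚ
  F = fromℕ (k !)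
  inv-fact : inv (fromℕ (suc k ℕ.* k !)) ≡ inv (K + 1ℚ) * inv F
  inv-fact = trans (cong inv (trans (fromℕ-* (suc k) (k !)) (cong (_* F) (fromℕ-suc k)))) (inv-* (K + 1ℚ) F)
  regroup : ∀ f d s i j → f * d * (i * j) * s ≡ f * j * d * (s * i)
  regroup = solve-∀ ℚ-ring

centralBinom-fact : ∀ k → ((2 ℕ.* k) C k) ℕ.* (k ! ℕ.* k !) ≡ (2 ℕ.* k) !
centralBinom-fact k = begin
  ((2 ℕ.* k) C k) ℕ.* (k ! ℕ.* k !)              ≡⟨ cong (λ j → ((2 ℕ.* k) C k) ℕ.* (k ! ℕ.* j !)) 2k∸k≡k ⟨
  ((2 ℕ.* k) C k) ℕ.* (k ! ℕ.* (2 ℕ.* k ∸ k) !)  ≡⟨ cong (ℕ._* (k ! ℕ.* (2 ℕ.* k ∸ k) !)) (nCk≡n!/k![n-k]! k≤2k) ⟩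
  _                                            ≡⟨ m/n*n≡m {{k ℕP.!* (2 ℕ.* k ∸ k) !≢0}} (k![n∸k]!∣n! k≤2k) ⟩
  (2 ℕ.* k) !                                  ∎
  where
  open ≡-Reasoning
  k≤2k : k ≤ 2 ℕ.* k
  k≤2k = ℕP.m≤m+n k (k ℕ.+ 0)
  2k∸k≡k : 2 ℕ.* k ∸ k ≡ k
  2k∸k≡k = trans (ℕP.m+n∸m≡n k (k ℕ.+ 0)) (ℕP.+-identityʳ k)

centralBinom-suc : ∀ k → ((2 ℕ.* suc k) C suc k) ℕ.* suc k ≡ 2 ℕ.* suc (2 ℕ.* k) ℕ.* ((2 ℕ.* k) C k)
centralBinom-suc k = ℕP.*-cancelʳ-≡ _ _ (suc k ℕ.* (k ! ℕ.* k !)) {{ℕP.m*n≢0 (suc k) _ {{_}} {{k ℕP.!* k !≢0}}}} (begin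
  B′ ℕ.* suc k ℕ.* (suc k ℕ.* (k ! ℕ.* k !))            ≡⟨ square-fact B′ k (k !) ⟩
  B′ ℕ.* (suc k ! ℕ.* suc k !)                           ≡⟨ centralBinom-fact (suc k) ⟩
  (2 ℕ.* suc k) !                                        ≡⟨ cong _! (2[1+k]≡2+2k k) ⟩
  suc (suc (2 ℕ.* k)) ℕ.* (suc (2 ℕ.* k) ℕ.* (2 ℕ.* k) !)  ≡⟨ cong (λ z → suc (suc (2 ℕ.* k)) ℕ.* (suc (2 ℕ.* k) ℕ.* z)) (centralBinom-fact k) ⟨
  suc (suc (2 ℕ.* k)) ℕ.* (suc (2 ℕ.* k) ℕ.* (B ℕ.* (k ! ℕ.* k !)))  ≡⟨ regroup k B (k ! ℕ.* k !) ⟩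
  2 ℕ.* suc (2 ℕ.* k) ℕ.* B ℕ.* (suc k ℕ.* (k ! ℕ.* k !))  ∎)
  where
  open ≡-Reasoning
  B′ : ℕ
  B′ = (2 ℕ.* suc k) C suc k
  B : ℕ
  B = (2 ℕ.* k) C k
  square-fact : ∀ c k f → c ℕ.* suc k ℕ.* (suc k ℕ.* (f ℕ.* f)) ≡ c ℕ.* ((suc k ℕ.* f) ℕ.* (suc k ℕ.* f))
  square-fact = ℕSolver.solve-∀
  2[1+k]≡2+2k : ∀ k → 2 ℕ.* suc k ≡ suc (suc (2 ℕ.* k))
  2[1+k]≡2+2k = ℕSolver.solve-∀
  regroup : ∀ k c g → suc (suc (2 ℕ.* k)) ℕ.* (suc (2 ℕ.* k) ℕ.* (c ℕ.* g)) ≡ 2 ℕ.* suc (2 ℕ.* k) ℕ.* c ℕ.* (suc k ℕ.* g)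
  regroup = ℕSolver.solve-∀

fromℕ-centralBinom-suc : ∀ k → let K = fromℕ k in
  fromℕ ((2 ℕ.* suc k) C suc k) * (K + 1ℚ) ≡ fromℕ 2 * (fromℕ 2 * K + 1ℚ) * fromℕ ((2 ℕ.* k) C k)
fromℕ-centralBinom-suc k = begin
  fromℕ B′ * (fromℕ k + 1ℚ)                          ≡⟨ cong (fromℕ B′ *_) (fromℕ-suc k) ⟨
  fromℕ B′ * fromℕ (suc k)                           ≡⟨ fromℕ-* B′ (suc k) ⟨
  fromℕ (B′ ℕ.* suc k)                               ≡⟨ cong fromℕ (centralBinom-suc k) ⟩
  fromℕ (2 ℕ.* suc (2 ℕ.* k) ℕ.* B)                  ≡⟨ fromℕ-* (2 ℕ.* suc (2 ℕ.* k)) B ⟩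
  fromℕ (2 ℕ.* suc (2 ℕ.* k)) * fromℕ B              ≡⟨ cong (_* fromℕ B) (fromℕ-* 2 (suc (2 ℕ.* k))) ⟩
  fromℕ 2 * fromℕ (suc (2 ℕ.* k)) * fromℕ B          ≡⟨ cong (λ z → fromℕ 2 * z * fromℕ B) (fromℕ-suc (2 ℕ.* k)) ⟩
  fromℕ 2 * (fromℕ (2 ℕ.* k) + 1ℚ) * fromℕ B         ≡⟨ cong (λ z → fromℕ 2 * (z + 1ℚ) * fromℕ B) (fromℕ-* 2 k) ⟩
  fromℕ 2 * (fromℕ 2 * fromℕ k + 1ℚ) * fromℕ B       ∎
  where
  open ≡-Reasoning
  B′ : ℕ
  B′ = (2 ℕ.* suc k) C suc k
  B : ℕ
  B = (2 ℕ.* k) C k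

c-suc : ∀ a k → let K = fromℕ k in
  c a (suc k) * ((K + 1ℚ) * (K + 1ℚ) * (K + 1ℚ))
    ≡ fromℕ 2 * (fromℕ 2 * K + 1ℚ) * (K * (K + 1ℚ) - a * (a + 1ℚ)) * c a k
c-suc a k = begin
  binom a (suc k) * binom b (suc k) * fromℕ B′ * ((K + 1ℚ) * (K + 1ℚ) * (K + 1ℚ))
    ≡⟨ distribute (binom a (suc k)) (binom b (suc k)) (fromℕ B′) (K + 1ℚ) ⟩
  binom a (suc k) * (K + 1ℚ) * (binom b (suc k) * (K + 1ℚ)) * (fromℕ B′ * (K + 1ℚ))
    ≡⟨ cong₂ _*_ (cong₂ _*_ (binom-suc a k) (binom-suc b k)) (fromℕ-centralBinom-suc k) ⟩
  binom a k * (a - K) * (binom b k * (b - K)) * (fromℕ 2 * (fromℕ 2 * K + 1ℚ) * fromℕ B)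
    ≡⟨ collect (binom a k) (binom b k) (fromℕ B) a K ⟩
  fromℕ 2 * (fromℕ 2 * K + 1ℚ) * (K * (K + 1ℚ) - a * (a + 1ℚ)) * c a k
    ∎
  where
  open ≡-Reasoning
  K : ℚ
  K = fromℕ k
  b : ℚ
  b = - 1ℚ - a
  B′ : ℕ
  B′ = (2 ℕ.* suc k) C suc k
  B : ℕ
  B = (2 ℕ.* k) C k
  distribute : ∀ x y z s → x * y * z * (s * s * s) ≡ x * s * (y * s) * (z * s)
  distribute = solve-∀ ℚ-ring
  collect : ∀ x y z a K → x * (a - K) * (y * (- 1ℚ - a - K)) * (fromℕ 2 * (fromℕ 2 * K + 1ℚ) * z)
                        ≡ fromℕ 2 * (fromℕ 2 * K + 1ℚ) * (K * (K + 1ℚ) - a * (a + 1ℚ)) * (x * y * z)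
  collect = solve-∀ ℚ-ring

-- Exact identities for the moments of a hypergeometric sequence

stationary : ∀ (h : ℕ → ℚ) → (∀ n → h (suc n) ≡ h n) → ∀ n → h n ≡ h 0
stationary h step zero = refl
stationary h step (suc n) = trans (step n) (stationary h step n)

≡-modulo : ∀ {x y z w} → z ≡ w → ∀ c → x ≡ y + c * (z - w) → x ≡ y
≡-modulo {y = y} {z} refl c x≡y+c[z-z] = begin
  _                 ≡⟨ x≡y+c[z-z] ⟩
  y + c * (z - z)   ≡⟨ cong (λ d → y + c * d) (+-inverseʳ z) ⟩
  y + c * 0ℚ        ≡⟨ cong (λ d → y + d) (*-zeroʳ c) ⟩
  y + 0ℚ            ≡⟨ +-identityʳ y ⟩
  y                 ∎
  where open ≡-Reasoning

S₃-elimination : ∀ m A J w s₃ s₂ s₁ s₀ t → (m - fromℕ 4) * J ≡ 1ℚ → w ≡ J * J → let M4 = m - fromℕ 4 in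
  s₃ - (((fromℕ 2 - fromℕ 4 * A) * M4 + fromℕ 12) * w * s₁ - fromℕ 2 * A * (m + fromℕ 8) * w * s₀ + fromℕ 12 * A * w * t)
  ≡ fromℕ 2 * J * (M4 * inv (fromℕ 2) * s₃ - (fromℕ 3 * s₂ - (fromℕ 2 * A - 1ℚ) * s₁ - A * s₀))
    + fromℕ 12 * (J * J) * (M4 * inv (fromℕ 2) * s₂ - (s₁ - fromℕ 2 * A * s₀ + A * t))
S₃-elimination m A J .(J * J) s₃ s₂ s₁ s₀ t M4J≡1 refl =
  ≡-modulo M4J≡1 (- (s₃ + fromℕ 6 * J * s₂ + (fromℕ 2 - fromℕ 4 * A) * J * s₁ - fromℕ 2 * A * J * s₀))
    (solve (m ∷ A ∷ J ∷ s₃ ∷ s₂ ∷ s₁ ∷ s₀ ∷ t ∷ []) ℚ-ring)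

inv-^2 : ∀ x → inv (x ^' 2) ≡ inv x * inv x
inv-^2 x = trans (inv-* (1ℚ * x) x) (cong (λ y → inv y * inv x) (*-identityˡ x))

module Moments (A m : ℚ) (m≢0 : m ≢ 0ℚ) (f : ℕ → ℚ)
  (f-suc : ∀ k → f (suc k) * ((fromℕ k + 1ℚ) * (fromℕ k + 1ℚ) * (fromℕ k + 1ℚ))
                  ≡ fromℕ 2 * (fromℕ 2 * fromℕ k + 1ℚ) * (fromℕ k * (fromℕ k + 1ℚ) - A) * f k)
  where

  u : ℕ → ℚ
  u k = f k ÷' (m ^' k)

  S₀ S₁ S₂ S₃ T : ℕ → ℚ
  S₀ n = sumTo n (λ k → f k ÷' (m ^' k))
  S₁ n = sumTo n (λ k → fromℕ k * f k ÷' (m ^' k))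
  S₂ n = sumTo n (λ k → fromℕ k ^' 2 * f k ÷' (m ^' k))
  S₃ n = sumTo n (λ k → fromℕ k ^' 3 * f k ÷' (m ^' k))
  T n = sumTo n (λ k → f k ÷' ((m ^' k) * fromℕ (suc k)))

  u-suc : ∀ k → let K = fromℕ k in
    m * ((K + 1ℚ) * (K + 1ℚ) * (K + 1ℚ)) * u (suc k) ≡ fromℕ 2 * (fromℕ 2 * K + 1ℚ) * (K * (K + 1ℚ) - A) * u k
  u-suc k = begin
    m * K₁³ * (f (suc k) * inv (m ^' k * m))             ≡⟨ cong (λ z → m * K₁³ * (f (suc k) * z)) (inv-* (m ^' k) m) ⟩
    m * K₁³ * (f (suc k) * (inv (m ^' k) * inv m))       ≡⟨ regroup m K₁³ (f (suc k)) (inv (m ^' k)) (inv m) ⟩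
    f (suc k) * K₁³ * inv (m ^' k) * (m * inv m)         ≡⟨ cong₂ (λ x y → x * inv (m ^' k) * y) (f-suc k) (*-inv m≢0) ⟩
    ρ * f k * inv (m ^' k) * 1ℚ                          ≡⟨ trans (*-identityʳ _) (*-assoc ρ (f k) (inv (m ^' k))) ⟩
    ρ * u k                                              ∎
    where
    open ≡-Reasoning
    K : ℚ
    K = fromℕ k
    K₁³ : ℚ
    K₁³ = (K + 1ℚ) * (K + 1ℚ) * (K + 1ℚ)
    ρ : ℚ
    ρ = fromℕ 2 * (fromℕ 2 * K + 1ℚ) * (K * (K + 1ℚ) - A)
    regroup : ∀ m c y i j → m * c * (y * (i * j)) ≡ y * c * i * (m * j)
    regroup = solve-∀ ℚ-ring

  private
    shifted-square : ∀ K I x y → (K + 1ℚ) * I ≡ 1ℚ →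
      m * ((K + 1ℚ) * (K + 1ℚ) * (K + 1ℚ)) * y ≡ fromℕ 2 * (fromℕ 2 * K + 1ℚ) * (K * (K + 1ℚ) - A) * x →
      m * ((K + 1ℚ) * (K + 1ℚ)) * y ≡ (fromℕ 4 * K * K + fromℕ 2 * K - fromℕ 4 * A) * x + fromℕ 2 * A * (x * I)
    shifted-square K I x y K₁I≡1 rec = begin
      m * ((K + 1ℚ) * (K + 1ℚ)) * y                                  ≡⟨ *-identityʳ _ ⟨
      m * ((K + 1ℚ) * (K + 1ℚ)) * y * 1ℚ                             ≡⟨ cong (m * ((K + 1ℚ) * (K + 1ℚ)) * y *_) K₁I≡1 ⟨
      m * ((K + 1ℚ) * (K + 1ℚ)) * y * ((K + 1ℚ) * I)                 ≡⟨ solve (m ∷ K ∷ y ∷ I ∷ []) ℚ-ring ⟩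
      m * ((K + 1ℚ) * (K + 1ℚ) * (K + 1ℚ)) * y * I                   ≡⟨ cong (_* I) rec ⟩
      fromℕ 2 * (fromℕ 2 * K + 1ℚ) * (K * (K + 1ℚ) - A) * x * I      ≡⟨ solve (A ∷ K ∷ x ∷ I ∷ []) ℚ-ring ⟩
      (fromℕ 4 * K * K + fromℕ 2 * K - fromℕ 4 * A) * x * ((K + 1ℚ) * I) + fromℕ 2 * A * (x * I)
        ≡⟨ cong (λ z → (fromℕ 4 * K * K + fromℕ 2 * K - fromℕ 4 * A) * x * z + fromℕ 2 * A * (x * I)) K₁I≡1 ⟩
      (fromℕ 4 * K * K + fromℕ 2 * K - fromℕ 4 * A) * x * 1ℚ + fromℕ 2 * A * (x * I)
        ≡⟨ cong (_+ fromℕ 2 * A * (x * I)) (*-identityʳ ((fromℕ 4 * K * K + fromℕ 2 * K - fromℕ 4 * A) * x)) ⟩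
      (fromℕ 4 * K * K + fromℕ 2 * K - fromℕ 4 * A) * x + fromℕ 2 * A * (x * I)  ∎
      where open ≡-Reasoning

    telescoping₁ : ∀ s₂ s₁ s₀ t K x i I y → (K + 1ℚ) * I ≡ 1ℚ →
      m * ((K + 1ℚ) * (K + 1ℚ) * (K + 1ℚ)) * y ≡ fromℕ 2 * (fromℕ 2 * K + 1ℚ) * (K * (K + 1ℚ) - A) * (x * i) →
      (m - fromℕ 4) * (s₂ + 1ℚ * K * K * x * i) - fromℕ 2 * (s₁ + K * x * i) + fromℕ 4 * A * (s₀ + x * i)
        - fromℕ 2 * A * (t + x * (i * I)) + m * ((K + 1ℚ) * (K + 1ℚ)) * y
      ≡ (m - fromℕ 4) * s₂ - fromℕ 2 * s₁ + fromℕ 4 * A * s₀ - fromℕ 2 * A * t + m * (K * K) * (x * i)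
    telescoping₁ s₂ s₁ s₀ t K x i I y K₁I≡1 rec = begin
      F + m * ((K + 1ℚ) * (K + 1ℚ)) * y
        ≡⟨ cong (λ z → F + z) (shifted-square K I (x * i) y K₁I≡1 rec) ⟩
      (m - fromℕ 4) * (s₂ + 1ℚ * K * K * x * i) - fromℕ 2 * (s₁ + K * x * i) + fromℕ 4 * A * (s₀ + x * i)
        - fromℕ 2 * A * (t + x * (i * I))
        + ((fromℕ 4 * K * K + fromℕ 2 * K - fromℕ 4 * A) * (x * i) + fromℕ 2 * A * (x * i * I))
        ≡⟨ solve (s₂ ∷ s₁ ∷ s₀ ∷ t ∷ K ∷ x ∷ i ∷ I ∷ m ∷ A ∷ []) ℚ-ring ⟩
      (m - fromℕ 4) * s₂ - fromℕ 2 * s₁ + fromℕ 4 * A * s₀ - fromℕ 2 * A * t + m * (K * K) * (x * i)  ∎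
      where
      open ≡-Reasoning
      F : ℚ
      F = (m - fromℕ 4) * (s₂ + 1ℚ * K * K * x * i) - fromℕ 2 * (s₁ + K * x * i) + fromℕ 4 * A * (s₀ + x * i)
            - fromℕ 2 * A * (t + x * (i * I))

    telescoping₂ : ∀ s₃ s₂ s₁ s₀ K x i y →
      m * ((K + 1ℚ) * (K + 1ℚ) * (K + 1ℚ)) * y ≡ fromℕ 2 * (fromℕ 2 * K + 1ℚ) * (K * (K + 1ℚ) - A) * (x * i) →
      (m - fromℕ 4) * (s₃ + 1ℚ * K * K * K * x * i) - fromℕ 6 * (s₂ + 1ℚ * K * K * x * i)
        - (fromℕ 2 - fromℕ 4 * A) * (s₁ + K * x * i) + fromℕ 2 * A * (s₀ + x * i)
        + m * ((K + 1ℚ) * (K + 1ℚ) * (K + 1ℚ)) * y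
      ≡ (m - fromℕ 4) * s₃ - fromℕ 6 * s₂ - (fromℕ 2 - fromℕ 4 * A) * s₁ + fromℕ 2 * A * s₀ + m * (K * K * K) * (x * i)
    telescoping₂ s₃ s₂ s₁ s₀ K x i y rec = begin
      F + m * ((K + 1ℚ) * (K + 1ℚ) * (K + 1ℚ)) * y
        ≡⟨ cong (λ z → F + z) rec ⟩
      (m - fromℕ 4) * (s₃ + 1ℚ * K * K * K * x * i) - fromℕ 6 * (s₂ + 1ℚ * K * K * x * i)
        - (fromℕ 2 - fromℕ 4 * A) * (s₁ + K * x * i) + fromℕ 2 * A * (s₀ + x * i)
        + fromℕ 2 * (fromℕ 2 * K + 1ℚ) * (K * (K + 1ℚ) - A) * (x * i)
        ≡⟨ solve (s₃ ∷ s₂ ∷ s₁ ∷ s₀ ∷ K ∷ x ∷ i ∷ m ∷ A ∷ []) ℚ-ring ⟩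
      (m - fromℕ 4) * s₃ - fromℕ 6 * s₂ - (fromℕ 2 - fromℕ 4 * A) * s₁ + fromℕ 2 * A * s₀ + m * (K * K * K) * (x * i)  ∎
      where
      open ≡-Reasoning
      F : ℚ
      F = (m - fromℕ 4) * (s₃ + 1ℚ * K * K * K * x * i) - fromℕ 6 * (s₂ + 1ℚ * K * K * x * i)
            - (fromℕ 2 - fromℕ 4 * A) * (s₁ + K * x * i) + fromℕ 2 * A * (s₀ + x * i)

  T-summand : ∀ k → f k ÷' ((m ^' k) * fromℕ (suc k)) ≡ f k * (inv (m ^' k) * inv (fromℕ k + 1ℚ))
  T-summand k = cong (f k *_) (trans (inv-* (m ^' k) (fromℕ (suc k))) (cong (λ z → inv (m ^' k) * inv z) (fromℕ-suc k)))

  Φ₁ Φ₂ : ℕ → ℚ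
  Φ₁ n = (m - fromℕ 4) * S₂ n - fromℕ 2 * S₁ n + fromℕ 4 * A * S₀ n - fromℕ 2 * A * T n
           + m * (fromℕ n * fromℕ n) * u n
  Φ₂ n = (m - fromℕ 4) * S₃ n - fromℕ 6 * S₂ n - (fromℕ 2 - fromℕ 4 * A) * S₁ n + fromℕ 2 * A * S₀ n
           + m * (fromℕ n * fromℕ n * fromℕ n) * u n

  Φ₁≡0 : ∀ n → Φ₁ n ≡ 0ℚ
  Φ₁≡0 n = trans (stationary Φ₁ Φ₁-suc n) (initial m A (u 0))
    where
    initial : ∀ m A x → (m - fromℕ 4) * 0ℚ - fromℕ 2 * 0ℚ + fromℕ 4 * A * 0ℚ - fromℕ 2 * A * 0ℚ + m * (0ℚ * 0ℚ) * x ≡ 0ℚ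
    initial = solve-∀ ℚ-ring
    Φ₁-suc : ∀ n → Φ₁ (suc n) ≡ Φ₁ n
    Φ₁-suc n = trans
      (cong₂ (λ t N₁ → (m - fromℕ 4) * S₂ (suc n) - fromℕ 2 * S₁ (suc n) + fromℕ 4 * A * S₀ (suc n)
                         - fromℕ 2 * A * (T n + t) + m * (N₁ * N₁) * u (suc n))
             (T-summand n) (fromℕ-suc n))
      (telescoping₁ (S₂ n) (S₁ n) (S₀ n) (T n) (fromℕ n) (f n) (inv (m ^' n)) (inv (fromℕ n + 1ℚ)) (u (suc n))
             (*-inv (fromℕ+1≢0 n)) (u-suc n))

  Φ₂≡0 : ∀ n → Φ₂ n ≡ 0ℚ
  Φ₂≡0 n = trans (stationary Φ₂ Φ₂-suc n) (initial m A (u 0))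
    where
    initial : ∀ m A x → (m - fromℕ 4) * 0ℚ - fromℕ 6 * 0ℚ - (fromℕ 2 - fromℕ 4 * A) * 0ℚ + fromℕ 2 * A * 0ℚ
                          + m * (0ℚ * 0ℚ * 0ℚ) * x ≡ 0ℚ
    initial = solve-∀ ℚ-ring
    Φ₂-suc : ∀ n → Φ₂ (suc n) ≡ Φ₂ n
    Φ₂-suc n = trans
      (cong (λ N₁ → (m - fromℕ 4) * S₃ (suc n) - fromℕ 6 * S₂ (suc n) - (fromℕ 2 - fromℕ 4 * A) * S₁ (suc n)
                      + fromℕ 2 * A * S₀ (suc n) + m * (N₁ * N₁ * N₁) * u (suc n))
            (fromℕ-suc n))
      (telescoping₂ (S₃ n) (S₂ n) (S₁ n) (S₀ n) (fromℕ n) (f n) (inv (m ^' n)) (u (suc n)) (u-suc n))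

  L₁ R₁ L₂ R₂ R₃ : ℕ → ℚ
  L₁ q = (m - fromℕ 4) ÷' fromℕ 2 * S₂ (suc q)
  R₁ q = S₁ (suc q) - fromℕ 2 * A * S₀ (suc q) + A * T q
  L₂ q = (m - fromℕ 4) ÷' fromℕ 2 * S₃ (suc q)
  R₂ q = fromℕ 3 * S₂ (suc q) - (fromℕ 2 * A - 1ℚ) * S₁ (suc q) - A * S₀ (suc q)
  R₃ q = ((fromℕ 2 - fromℕ 4 * A) * (m - fromℕ 4) + fromℕ 12) ÷' ((m - fromℕ 4) ^' 2) * S₁ (suc q)
         - fromℕ 2 * A * (m + fromℕ 8) ÷' ((m - fromℕ 4) ^' 2) * S₀ (suc q)
         + fromℕ 12 * A ÷' ((m - fromℕ 4) ^' 2) * T q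

  defect₁ : ∀ q → let Q = fromℕ q in
    L₁ q - R₁ q ≡ (fromℕ 2 * A - (fromℕ 2 * Q + 1ℚ) * Q) * u q
  defect₁ q = ≡-modulo (Φ₁≡0 q) (inv (fromℕ 2)) (expand m A (S₂ q) (S₁ q) (S₀ q) (T q) (fromℕ q) (f q) (inv (m ^' q)))
    where
    expand : ∀ m A s₂ s₁ s₀ t Q x i →
      (m - fromℕ 4) * inv (fromℕ 2) * (s₂ + 1ℚ * Q * Q * x * i)
        - (s₁ + Q * x * i - fromℕ 2 * A * (s₀ + x * i) + A * t)
      ≡ (fromℕ 2 * A - (fromℕ 2 * Q + 1ℚ) * Q) * (x * i)
        + inv (fromℕ 2) * ((m - fromℕ 4) * s₂ - fromℕ 2 * s₁ + fromℕ 4 * A * s₀ - fromℕ 2 * A * t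
                           + m * (Q * Q) * (x * i) - 0ℚ)
    expand = solve-∀ ℚ-ring

  defect₂ : ∀ q → let Q = fromℕ q in
    L₂ q - R₂ q ≡ - ((fromℕ 2 * Q + 1ℚ) * (Q * (Q + 1ℚ) - A)) * u q
  defect₂ q = ≡-modulo (Φ₂≡0 q) (inv (fromℕ 2)) (expand m A (S₃ q) (S₂ q) (S₁ q) (S₀ q) (fromℕ q) (f q) (inv (m ^' q)))
    where
    expand : ∀ m A s₃ s₂ s₁ s₀ Q x i →
      (m - fromℕ 4) * inv (fromℕ 2) * (s₃ + 1ℚ * Q * Q * Q * x * i)
        - (fromℕ 3 * (s₂ + 1ℚ * Q * Q * x * i) - (fromℕ 2 * A - 1ℚ) * (s₁ + Q * x * i) - A * (s₀ + x * i))
      ≡ - ((fromℕ 2 * Q + 1ℚ) * (Q * (Q + 1ℚ) - A)) * (x * i)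
        + inv (fromℕ 2) * ((m - fromℕ 4) * s₃ - fromℕ 6 * s₂ - (fromℕ 2 - fromℕ 4 * A) * s₁ + fromℕ 2 * A * s₀
                           + m * (Q * Q * Q) * (x * i) - 0ℚ)
    expand = solve-∀ ℚ-ring

  defect₃ : ∀ q {J} → (m - fromℕ 4) * J ≡ 1ℚ →
    S₃ (suc q) - R₃ q ≡ fromℕ 2 * J * (L₂ q - R₂ q) + fromℕ 12 * (J * J) * (L₁ q - R₁ q)
  defect₃ q {J} M4J≡1 = S₃-elimination m A J (inv ((m - fromℕ 4) ^' 2)) (S₃ (suc q)) (S₂ (suc q)) (S₁ (suc q)) (S₀ (suc q)) (T q)
    M4J≡1 (trans (inv-^2 (m - fromℕ 4)) (cong (λ i → i * i) (inv-unique {m - fromℕ 4} {J} M4J≡1)))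

-- Divisibility by powers of p in ℤ₍ₚ₎

module Valuation (p : ℕ) (p-prime : Prime p) where

  instance
    p≢0 : ℕ.NonZero p
    p≢0 = prime⇒nonZero p-prime

  -- e ≤ᵥ x says that x = pᵉ · numer / denom with p ∤ denom, i.e. that e ≤ vₚ(x).
  infix 4 _≤ᵥ_
  record _≤ᵥ_ (e : ℕ) (x : ℚ) : Set where
    field
      numer denom : ℤ
      p∤denom : ¬ p ∣ ℤ.∣ denom ∣
      scaled : x * fromℤ denom ≡ fromℕ (p ℕ.^ e) * fromℤ numer

  p∤1 : ¬ p ∣ 1
  p∤1 p∣1 = ¬prime[1] (subst Prime (ℕD.∣1⇒≡1 p∣1) p-prime)

  p∤* : ∀ {D₁ D₂} → ¬ p ∣ ℤ.∣ D₁ ∣ → ¬ p ∣ ℤ.∣ D₂ ∣ → ¬ p ∣ ℤ.∣ D₁ ℤ.* D₂ ∣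
  p∤* {D₁} {D₂} p∤D₁ p∤D₂ p∣D₁D₂ with euclidsLemma ℤ.∣ D₁ ∣ ℤ.∣ D₂ ∣ p-prime (subst (p ∣_) (ℤP.abs-* D₁ D₂) p∣D₁D₂)
  ... | inj₁ p∣D₁ = p∤D₁ p∣D₁
  ... | inj₂ p∣D₂ = p∤D₂ p∣D₂

  ≤ᵥ-+ : ∀ {e x y} → e ≤ᵥ x → e ≤ᵥ y → e ≤ᵥ (x + y)
  ≤ᵥ-+ {e} {x} {y} record { numer = K₁ ; denom = D₁ ; p∤denom = p∤D₁ ; scaled = x≡ }
                   record { numer = K₂ ; denom = D₂ ; p∤denom = p∤D₂ ; scaled = y≡ } = record
    { numer = K₁ ℤ.* D₂ ℤ.+ K₂ ℤ.* D₁ ; denom = D₁ ℤ.* D₂ ; p∤denom = p∤* {D₁} {D₂} p∤D₁ p∤D₂ ; scaled = begin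
      (x + y) * fromℤ (D₁ ℤ.* D₂)                  ≡⟨ cong ((x + y) *_) (fromℤ-* D₁ D₂) ⟩
      (x + y) * (fromℤ D₁ * fromℤ D₂)              ≡⟨ distribute x y (fromℤ D₁) (fromℤ D₂) ⟩
      x * fromℤ D₁ * fromℤ D₂ + y * fromℤ D₂ * fromℤ D₁   ≡⟨ cong₂ (λ s t → s * fromℤ D₂ + t * fromℤ D₁) x≡ y≡ ⟩
      P * fromℤ K₁ * fromℤ D₂ + P * fromℤ K₂ * fromℤ D₁   ≡⟨ factor P (fromℤ K₁) (fromℤ D₂) (fromℤ K₂) (fromℤ D₁) ⟩
      P * (fromℤ K₁ * fromℤ D₂ + fromℤ K₂ * fromℤ D₁)     ≡⟨ cong (P *_) (sym (trans (fromℤ-+ (K₁ ℤ.* D₂) (K₂ ℤ.* D₁)) (cong₂ _+_ (fromℤ-* K₁ D₂) (fromℤ-* K₂ D₁)))) ⟩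
      P * fromℤ (K₁ ℤ.* D₂ ℤ.+ K₂ ℤ.* D₁)                 ∎ }
    where
    open ≡-Reasoning
    P : ℚ
    P = fromℕ (p ℕ.^ e)
    distribute : ∀ x y d₁ d₂ → (x + y) * (d₁ * d₂) ≡ x * d₁ * d₂ + y * d₂ * d₁
    distribute = solve-∀ ℚ-ring
    factor : ∀ P k₁ d₂ k₂ d₁ → P * k₁ * d₂ + P * k₂ * d₁ ≡ P * (k₁ * d₂ + k₂ * d₁)
    factor = solve-∀ ℚ-ring

  ≤ᵥ-* : ∀ {e f x y} → e ≤ᵥ x → f ≤ᵥ y → (e ℕ.+ f) ≤ᵥ (x * y)
  ≤ᵥ-* {e} {f} {x} {y} record { numer = K₁ ; denom = D₁ ; p∤denom = p∤D₁ ; scaled = x≡ }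
                       record { numer = K₂ ; denom = D₂ ; p∤denom = p∤D₂ ; scaled = y≡ } = record
    { numer = K₁ ℤ.* K₂ ; denom = D₁ ℤ.* D₂ ; p∤denom = p∤* {D₁} {D₂} p∤D₁ p∤D₂ ; scaled = begin
      x * y * fromℤ (D₁ ℤ.* D₂)                         ≡⟨ cong (x * y *_) (fromℤ-* D₁ D₂) ⟩
      x * y * (fromℤ D₁ * fromℤ D₂)                     ≡⟨ interchange x y (fromℤ D₁) (fromℤ D₂) ⟩
      x * fromℤ D₁ * (y * fromℤ D₂)                     ≡⟨ cong₂ _*_ x≡ y≡ ⟩
      fromℕ (p ℕ.^ e) * fromℤ K₁ * (fromℕ (p ℕ.^ f) * fromℤ K₂)   ≡⟨ interchange (fromℕ (p ℕ.^ e)) (fromℤ K₁) (fromℕ (p ℕ.^ f)) (fromℤ K₂) ⟩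
      fromℕ (p ℕ.^ e) * fromℕ (p ℕ.^ f) * (fromℤ K₁ * fromℤ K₂)   ≡⟨ cong₂ _*_ p^[e+f] (fromℤ-* K₁ K₂) ⟨
      fromℕ (p ℕ.^ (e ℕ.+ f)) * fromℤ (K₁ ℤ.* K₂)                 ∎ }
    where
    open ≡-Reasoning
    interchange : ∀ x y d₁ d₂ → x * y * (d₁ * d₂) ≡ x * d₁ * (y * d₂)
    interchange = solve-∀ ℚ-ring
    p^[e+f] : fromℕ (p ℕ.^ (e ℕ.+ f)) ≡ fromℕ (p ℕ.^ e) * fromℕ (p ℕ.^ f)
    p^[e+f] = trans (cong fromℕ (ℕP.^-distribˡ-+-* p e f)) (fromℕ-* (p ℕ.^ e) (p ℕ.^ f))

  0≤ᵥ-fromℤ : ∀ N → 0 ≤ᵥ fromℤ N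
  0≤ᵥ-fromℤ N = record
    { numer = N ; denom = + 1 ; p∤denom = p∤1 ; scaled = trans (*-identityʳ (fromℤ N)) (sym (*-identityˡ (fromℤ N))) }

  0≤ᵥ-fromℕ : ∀ n → 0 ≤ᵥ fromℕ n
  0≤ᵥ-fromℕ n = 0≤ᵥ-fromℤ (+ n)

  p∣⇒1≤ᵥ : ∀ {n} → p ∣ n → 1 ≤ᵥ fromℕ n
  p∣⇒1≤ᵥ (divides-refl d) = record
    { numer = + d ; denom = + 1 ; p∤denom = p∤1 ; scaled = begin
      fromℕ (d ℕ.* p) * 1ℚ     ≡⟨ *-identityʳ _ ⟩
      fromℕ (d ℕ.* p)          ≡⟨ cong fromℕ (commute d p) ⟩
      fromℕ (p ℕ.* 1 ℕ.* d)    ≡⟨ fromℕ-* (p ℕ.* 1) d ⟩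
      fromℕ (p ℕ.* 1) * fromℕ d  ∎ }
    where
    open ≡-Reasoning
    commute : ∀ d p → d ℕ.* p ≡ p ℕ.* 1 ℕ.* d
    commute = ℕSolver.solve-∀

  1≤ᵥp : 1 ≤ᵥ fromℕ p
  1≤ᵥp = p∣⇒1≤ᵥ ℕD.∣-refl

  ≤ᵥ-neg : ∀ {e x} → e ≤ᵥ x → e ≤ᵥ (- x)
  ≤ᵥ-neg {x = x} e≤x = subst (_ ≤ᵥ_) (neg-as-product x) (≤ᵥ-* (0≤ᵥ-fromℤ (ℤ.- + 1)) e≤x)
    where
    neg-as-product : ∀ x → - 1ℚ * x ≡ - x
    neg-as-product = solve-∀ ℚ-ring

  ≤ᵥ-- : ∀ {e x y} → e ≤ᵥ x → e ≤ᵥ y → e ≤ᵥ (x - y)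
  ≤ᵥ-- e≤x e≤y = ≤ᵥ-+ e≤x (≤ᵥ-neg e≤y)

  0≤ᵥ-inv : ∀ {x D N} → x * fromℤ D ≡ fromℤ N → ¬ p ∣ ℤ.∣ N ∣ → 0 ≤ᵥ inv x
  0≤ᵥ-inv {x} {D} {N} xD≡N p∤N = record { numer = D ; denom = N ; p∤denom = p∤N ; scaled = begin
    inv x * fromℤ N              ≡⟨ cong (inv x *_) xD≡N ⟨
    inv x * (x * fromℤ D)        ≡⟨ regroup x (inv x) (fromℤ D) ⟩
    x * inv x * fromℤ D          ≡⟨ cong (_* fromℤ D) (*-inv x≢0) ⟩
    1ℚ * fromℤ D                 ∎ }
    where
    open ≡-Reasoning
    regroup : ∀ x i d → i * (x * d) ≡ x * i * d
    regroup = solve-∀ ℚ-ring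
    x≢0 : x ≢ 0ℚ
    x≢0 refl = p∤N (subst (λ M → p ∣ ℤ.∣ M ∣) (fromℤ-injective {+ 0} {N} (trans (sym (*-zeroˡ (fromℤ D))) xD≡N)) (p ℕD.∣0))

  InZp⇒0≤ᵥ : ∀ {x} → InZp p x → 0 ≤ᵥ x
  InZp⇒0≤ᵥ {x} x∈ℤₚ = record
    { numer = ↥ x ; denom = ↧ x ; p∤denom = x∈ℤₚ ; scaled = trans (numerator-denominator x) (sym (*-identityˡ _)) }

  0≤ᵥ-inv-^ : ∀ {x} → 0 ≤ᵥ inv x → ∀ k → 0 ≤ᵥ inv (x ^' k)
  0≤ᵥ-inv-^ 0≤x⁻¹ zero = 0≤ᵥ-fromℕ 1
  0≤ᵥ-inv-^ {x} 0≤x⁻¹ (suc k) = subst (0 ≤ᵥ_) (sym (inv-* (x ^' k) x)) (≤ᵥ-* (0≤ᵥ-inv-^ 0≤x⁻¹ k) 0≤x⁻¹)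

  prime-power-divides : ∀ {d n} e → ¬ p ∣ d → p ℕ.^ e ∣ d ℕ.* n → p ℕ.^ e ∣ n
  prime-power-divides {n = n} zero p∤d _ = ℕD.1∣ n
  prime-power-divides {d} {n} (suc e) p∤d p^[1+e]∣dn
    with euclidsLemma d n p-prime (ℕD.∣-trans (ℕD.m∣m*n (p ℕ.^ e)) p^[1+e]∣dn)
  ... | inj₁ p∣d = contradiction p∣d p∤d
  ... | inj₂ (divides-refl n′) = subst (p ℕ.* p ℕ.^ e ∣_) (ℕP.*-comm p n′) (ℕD.*-monoʳ-∣ p (prime-power-divides e p∤d p^e∣dn′))
    where
    rearrange : ∀ d n p → d ℕ.* (n ℕ.* p) ≡ p ℕ.* (d ℕ.* n)
    rearrange = ℕSolver.solve-∀
    p^e∣dn′ : p ℕ.^ e ∣ d ℕ.* n′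
    p^e∣dn′ = ℕD.*-cancelˡ-∣ p (subst (p ℕ.* p ℕ.^ e ∣_) (rearrange d n′ p) p^[1+e]∣dn)

  ≤ᵥ⇒CongMod : ∀ {e} x y → e ≤ᵥ (x - y) → CongMod p e x y
  ≤ᵥ⇒CongMod {e} x y record { numer = K ; denom = D ; p∤denom = p∤D ; scaled = zD≡PK } =
    prime-power-divides e p∤D (divides (ℤ.∣ K ∣ ℕ.* ℤ.∣ ↧ z ∣) (begin
      ℤ.∣ D ∣ ℕ.* ℤ.∣ ↥ z ∣              ≡⟨ ℕP.*-comm ℤ.∣ D ∣ _ ⟩
      ℤ.∣ ↥ z ∣ ℕ.* ℤ.∣ D ∣              ≡⟨ ℤP.abs-* (↥ z) D ⟨
      ℤ.∣ ↥ z ℤ.* D ∣                     ≡⟨ cong ℤ.∣_∣ (fromℤ-injective {↥ z ℤ.* D} {+ (p ℕ.^ e) ℤ.* K ℤ.* ↧ z} cross-multiplied) ⟩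
      ℤ.∣ + (p ℕ.^ e) ℤ.* K ℤ.* ↧ z ∣     ≡⟨ ℤP.abs-* (+ (p ℕ.^ e) ℤ.* K) (↧ z) ⟩
      ℤ.∣ + (p ℕ.^ e) ℤ.* K ∣ ℕ.* ℤ.∣ ↧ z ∣   ≡⟨ cong (ℕ._* ℤ.∣ ↧ z ∣) (ℤP.abs-* (+ (p ℕ.^ e)) K) ⟩
      p ℕ.^ e ℕ.* ℤ.∣ K ∣ ℕ.* ℤ.∣ ↧ z ∣       ≡⟨ rotate (p ℕ.^ e) ℤ.∣ K ∣ ℤ.∣ ↧ z ∣ ⟩
      ℤ.∣ K ∣ ℕ.* ℤ.∣ ↧ z ∣ ℕ.* p ℕ.^ e       ∎))
    where
    open ≡-Reasoning
    z : ℚ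
    z = x - y
    rotate : ∀ a b c → a ℕ.* b ℕ.* c ≡ b ℕ.* c ℕ.* a
    rotate = ℕSolver.solve-∀
    cross-multiplied : fromℤ (↥ z ℤ.* D) ≡ fromℤ (+ (p ℕ.^ e) ℤ.* K ℤ.* ↧ z)
    cross-multiplied = begin
      fromℤ (↥ z ℤ.* D)                               ≡⟨ fromℤ-* (↥ z) D ⟩
      fromℤ (↥ z) * fromℤ D                           ≡⟨ cong (_* fromℤ D) (numerator-denominator z) ⟨
      z * fromℤ (↧ z) * fromℤ D                       ≡⟨ swap z (fromℤ (↧ z)) (fromℤ D) ⟩
      z * fromℤ D * fromℤ (↧ z)                       ≡⟨ cong (_* fromℤ (↧ z)) zD≡PK ⟩
      fromℕ (p ℕ.^ e) * fromℤ K * fromℤ (↧ z)        ≡⟨ cong (_* fromℤ (↧ z)) (fromℤ-* (+ (p ℕ.^ e)) K) ⟨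
      fromℤ (+ (p ℕ.^ e) ℤ.* K) * fromℤ (↧ z)         ≡⟨ fromℤ-* (+ (p ℕ.^ e) ℤ.* K) (↧ z) ⟨
      fromℤ (+ (p ℕ.^ e) ℤ.* K ℤ.* ↧ z)               ∎
      where
      swap : ∀ x y z → x * y * z ≡ x * z * y
      swap = solve-∀ ℚ-ring

  ¬CongMod⇒≢ : ∀ x y → ¬ CongMod p 1 x y → x - y ≢ 0ℚ
  ¬CongMod⇒≢ x y x≢y x-y≡0 = x≢y (subst (λ z → p ℕ.^ 1 ∣ ℤ.∣ ↥ z ∣) (sym x-y≡0) ((p ℕ.^ 1) ℕD.∣0))

  ¬CongMod⇒0≤ᵥinv : ∀ x y → ¬ CongMod p 1 x y → 0 ≤ᵥ inv (x - y)
  ¬CongMod⇒0≤ᵥinv x y x≢y = 0≤ᵥ-inv {x - y} {↧ (x - y)} {↥ (x - y)} (numerator-denominator (x - y))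
    (λ p∣ → x≢y (subst (_∣ ℤ.∣ ↥ (x - y) ∣) (sym (ℕP.*-identityʳ p)) p∣))

  private
    1+ab≡cd⇒ℚ : ∀ {a b c d} → 1 ℕ.+ a ℕ.* b ≡ c ℕ.* d → 1ℚ + fromℕ a * fromℕ b ≡ fromℕ c * fromℕ d
    1+ab≡cd⇒ℚ {a} {b} {c} {d} eq = begin
      1ℚ + fromℕ a * fromℕ b     ≡⟨ cong (λ t → 1ℚ + t) (fromℕ-* a b) ⟨
      1ℚ + fromℕ (a ℕ.* b)       ≡⟨ fromℕ-+ 1 (a ℕ.* b) ⟨
      fromℕ (1 ℕ.+ a ℕ.* b)      ≡⟨ cong fromℕ eq ⟩
      fromℕ (c ℕ.* d)            ≡⟨ fromℕ-* c d ⟩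
      fromℕ c * fromℕ d          ∎
      where open ≡-Reasoning

    1≤ᵥ-*p : ∀ y → 1 ≤ᵥ fromℕ y * fromℕ p
    1≤ᵥ-*p y = ≤ᵥ-* (0≤ᵥ-fromℕ y) 1≤ᵥp

  modular-inverse : ∀ {n} → ¬ p ∣ n → Σ[ X ∈ ℤ ] 1 ≤ᵥ (fromℕ n * fromℤ X - 1ℚ)
  modular-inverse {n} p∤n with coprime-Bézout n-coprime-p
    where
    n-coprime-p : Coprime n p
    n-coprime-p (i∣n , i∣p) with prime⇒irreducible p-prime i∣p
    ... | inj₁ i≡1 = i≡1
    ... | inj₂ refl = contradiction i∣n p∤n
  ... | Bézout.+- x y 1+yp≡xn =
    + x , subst (1 ≤ᵥ_) (sym (+-case (fromℕ n) (fromℕ x) (fromℕ y) (fromℕ p) (1+ab≡cd⇒ℚ {y} {p} {x} {n} 1+yp≡xn))) (1≤ᵥ-*p y)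
    where
    +-case : ∀ n x y p → 1ℚ + y * p ≡ x * n → n * x - 1ℚ ≡ y * p
    +-case n x y p eq = ≡-modulo eq (- 1ℚ) (solve (n ∷ x ∷ y ∷ p ∷ []) ℚ-ring)
  ... | Bézout.-+ x y 1+xn≡yp =
    ℤ.- + x , subst (1 ≤ᵥ_) (sym (trans (cong (λ X → fromℕ n * X - 1ℚ) (fromℤ-neg (+ x)))
                                          (-+-case (fromℕ n) (fromℕ x) (fromℕ y) (fromℕ p) (1+ab≡cd⇒ℚ {x} {n} {y} {p} 1+xn≡yp))))
                    (≤ᵥ-neg (1≤ᵥ-*p y))
    where
    -+-case : ∀ n x y p → 1ℚ + x * n ≡ y * p → n * - x - 1ℚ ≡ - (y * p)
    -+-case n x y p eq = ≡-modulo eq (- 1ℚ) (solve (n ∷ x ∷ y ∷ p ∷ []) ℚ-ring)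

  residue : ∀ {x} → InZp p x → Σ[ r ∈ ℕ ] r < p × 1 ≤ᵥ (x - fromℕ r)
  residue {x} x∈ℤₚ with modular-inverse x∈ℤₚ
  ... | X , 1≤nX-1 = t %ℕ p , n%ℕd<d t p , subst (1 ≤ᵥ_) (split x (fromℤ t) (fromℕ (t %ℕ p))) (≤ᵥ-+ 1≤x-t 1≤t-r)
    where
    t : ℤ
    t = ↥ x ℤ.* X
    split : ∀ x t r → (x - t) + (t - r) ≡ x - r
    split = solve-∀ ℚ-ring
    unfold-inverse : ∀ x n X t → t ≡ x * n * X → - (x * (n * X - 1ℚ)) ≡ x - t
    unfold-inverse x n X t eq = ≡-modulo eq 1ℚ (solve (x ∷ n ∷ X ∷ t ∷ []) ℚ-ring)
    1≤x-t : 1 ≤ᵥ (x - fromℤ t)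
    1≤x-t = subst (1 ≤ᵥ_)
      (unfold-inverse x (fromℤ (↧ x)) (fromℤ X) (fromℤ t)
        (trans (fromℤ-* (↥ x) X) (cong (_* fromℤ X) (sym (numerator-denominator x)))))
      (≤ᵥ-neg (≤ᵥ-* (InZp⇒0≤ᵥ {x} x∈ℤₚ) 1≤nX-1))
    cancel-residue : ∀ t r s → t ≡ r + s → s ≡ t - r
    cancel-residue t r s eq = ≡-modulo eq (- 1ℚ) (solve (t ∷ r ∷ s ∷ []) ℚ-ring)
    1≤t-r : 1 ≤ᵥ (fromℤ t - fromℕ (t %ℕ p))
    1≤t-r = subst (1 ≤ᵥ_)
      (cancel-residue (fromℤ t) (fromℕ (t %ℕ p)) _
        (trans (cong fromℤ (a≡a%ℕn+[a/ℕn]*n t p))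
               (trans (fromℤ-+ (+ (t %ℕ p)) ((t /ℕ p) ℤ.* + p)) (cong (λ s → fromℕ (t %ℕ p) + s) (fromℤ-* (t /ℕ p) (+ p))))))
      (≤ᵥ-* (0≤ᵥ-fromℤ (t /ℕ p)) 1≤ᵥp)

  p∤k! : ∀ {k} → k < p → ¬ p ∣ k !
  p∤k! {zero} _ = p∤1
  p∤k! {suc k} 1+k<p p∣[1+k]! with euclidsLemma (suc k) (k !) p-prime p∣[1+k]!
  ... | inj₁ p∣1+k = ℕP.<⇒≱ 1+k<p (ℕD.∣⇒≤ p∣1+k)
  ... | inj₂ p∣k! = p∤k! (ℕP.<-trans (ℕP.n<1+n k) 1+k<p) p∣k!

  0≤ᵥ-falling : ∀ {x} → 0 ≤ᵥ x → ∀ k → 0 ≤ᵥ falling x k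
  0≤ᵥ-falling 0≤x zero = 0≤ᵥ-fromℕ 1
  0≤ᵥ-falling 0≤x (suc k) = ≤ᵥ-* (0≤ᵥ-falling 0≤x k) (≤ᵥ-- 0≤x (0≤ᵥ-fromℕ k))

  1≤ᵥ-falling : ∀ {x j k} → 0 ≤ᵥ x → j < k → 1 ≤ᵥ (x - fromℕ j) → 1 ≤ᵥ falling x k
  1≤ᵥ-falling {j = j} {suc k} 0≤x j<1+k 1≤x-j with j ℕ.≟ k
  ... | yes refl = ≤ᵥ-* (0≤ᵥ-falling 0≤x k) 1≤x-j
  ... | no j≢k = ≤ᵥ-* (1≤ᵥ-falling 0≤x (ℕP.≤∧≢⇒< (ℕP.≤-pred j<1+k) j≢k) 1≤x-j) (≤ᵥ-- 0≤x (0≤ᵥ-fromℕ k))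

  1≤ᵥ-binom : ∀ {x j k} → 0 ≤ᵥ x → j < k → k < p → 1 ≤ᵥ (x - fromℕ j) → 1 ≤ᵥ binom x k
  1≤ᵥ-binom {k = k} 0≤x j<k k<p 1≤x-j =
    ≤ᵥ-* (1≤ᵥ-falling 0≤x j<k 1≤x-j) (0≤ᵥ-inv {fromℕ (k !)} {+ 1} {+ (k !)} (*-identityʳ _) (p∤k! k<p))

  p∣centralBinom : ∀ {q} → p ≡ suc q → p ∣ (2 ℕ.* q) C q
  p∣centralBinom {q} refl with euclidsLemma ((2 ℕ.* q) C q) (q ! ℕ.* q !) p-prime p∣B*q!q!
    where
    1≤q : 1 ≤ q
    1≤q = ℕP.≤-pred (ℕ.nonTrivial⇒n>1 p {{prime⇒nonTrivial p-prime}})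
    p≤2q : suc q ≤ 2 ℕ.* q
    p≤2q = subst₂ _≤_ (ℕP.+-comm q 1) (cong (q ℕ.+_) (sym (ℕP.+-identityʳ q))) (ℕP.+-monoʳ-≤ q 1≤q)
    p∣B*q!q! : suc q ∣ ((2 ℕ.* q) C q) ℕ.* (q ! ℕ.* q !)
    p∣B*q!q! = subst (suc q ∣_) (sym (centralBinom-fact q)) (ℕD.∣-trans (ℕD.m∣m*n (q !)) (ℕD.m≤n⇒m!∣n! p≤2q))
  ... | inj₁ p∣B = p∣B
  ... | inj₂ p∣q!q! with euclidsLemma (q !) (q !) p-prime p∣q!q!
  ...   | inj₁ p∣q! = contradiction p∣q! (p∤k! (ℕP.n<1+n q))
  ...   | inj₂ p∣q! = contradiction p∣q! (p∤k! (ℕP.n<1+n q))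

  private
    a+1≡[a-r]+p : ∀ a {r} → p ≡ suc r → a - (- 1ℚ) ≡ (a - fromℕ r) + fromℕ p
    a+1≡[a-r]+p a {r} refl = shift a (fromℕ r) (fromℕ (suc r)) (fromℕ-suc r)
      where
      shift : ∀ a R P → P ≡ R + 1ℚ → a - (- 1ℚ) ≡ (a - R) + P
      shift a R P eq = ≡-modulo eq (- 1ℚ) (solve (a ∷ R ∷ P ∷ []) ℚ-ring)

    -1-a-[q-r]≡-[a-r]-p : ∀ a {q r} → p ≡ suc q → r ≤ q → (- 1ℚ - a) - fromℕ (q ∸ r) ≡ - (a - fromℕ r) - fromℕ p
    -1-a-[q-r]≡-[a-r]-p a {q} {r} refl r≤q = reflect a (fromℕ (q ∸ r)) (fromℕ r) (fromℕ (suc q)) p≡[q-r]+r+1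
      where
      reflect : ∀ a J R P → P ≡ J + R + 1ℚ → (- 1ℚ - a) - J ≡ - (a - R) - P
      reflect a J R P eq = ≡-modulo eq 1ℚ (solve (a ∷ J ∷ R ∷ P ∷ []) ℚ-ring)
      p≡[q-r]+r+1 : fromℕ (suc q) ≡ fromℕ (q ∸ r) + fromℕ r + 1ℚ
      p≡[q-r]+r+1 = trans (fromℕ-suc q) (cong (_+ 1ℚ) (trans (cong fromℕ (sym (ℕP.m∸n+n≡m r≤q))) (fromℕ-+ (q ∸ r) r)))

  residue-in-range : ∀ {a q} → p ≡ suc q → InZp p a → ¬ CongMod p 1 a 0ℚ → ¬ CongMod p 1 a (- 1ℚ) →
    Σ[ r ∈ ℕ ] 0 < r × r < q × 1 ≤ᵥ (a - fromℕ r)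
  residue-in-range {a} {q} p≡1+q a∈ℤₚ a≢0 a≢-1 = exclude-ends (residue {a} a∈ℤₚ)
    where
    below-q : ∀ {r} → r < p → 1 ≤ᵥ (a - fromℕ r) → Dec (r ≡ q) → r < q
    below-q {r} _ 1≤a-r (yes refl) =
      contradiction (≤ᵥ⇒CongMod a (- 1ℚ) (subst (1 ≤ᵥ_) (sym (a+1≡[a-r]+p a p≡1+q)) (≤ᵥ-+ 1≤a-r 1≤ᵥp))) a≢-1
    below-q {r} r<p _ (no r≢q) = ℕP.≤∧≢⇒< (ℕP.≤-pred (subst (r <_) p≡1+q r<p)) r≢q
    exclude-ends : Σ[ r ∈ ℕ ] r < p × 1 ≤ᵥ (a - fromℕ r) → Σ[ r ∈ ℕ ] 0 < r × r < q × 1 ≤ᵥ (a - fromℕ r)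
    exclude-ends (zero , _ , 1≤a-0) = contradiction (≤ᵥ⇒CongMod a 0ℚ 1≤a-0) a≢0
    exclude-ends (suc r , r<p , 1≤a-r) = suc r , ℕ.z<s , below-q r<p 1≤a-r (suc r ℕ.≟ q) , 1≤a-r

  3≤ᵥ-c : ∀ {a q} → p ≡ suc q → InZp p a → ¬ CongMod p 1 a 0ℚ → ¬ CongMod p 1 a (- 1ℚ) → 3 ≤ᵥ c a q
  3≤ᵥ-c {a} {q} p≡1+q a∈ℤₚ a≢0 a≢-1 = divisible (residue-in-range {a} p≡1+q a∈ℤₚ a≢0 a≢-1)
    where
    q<p : q < p
    q<p = subst (q <_) (sym p≡1+q) (ℕP.n<1+n q)
    0≤a : 0 ≤ᵥ a
    0≤a = InZp⇒0≤ᵥ {a} a∈ℤₚ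
    0≤b : 0 ≤ᵥ (- 1ℚ - a)
    0≤b = ≤ᵥ-- (≤ᵥ-neg (0≤ᵥ-fromℕ 1)) 0≤a
    divisible : Σ[ r ∈ ℕ ] 0 < r × r < q × 1 ≤ᵥ (a - fromℕ r) → 3 ≤ᵥ c a q
    divisible (r , 0<r , r<q , 1≤a-r) =
      ≤ᵥ-* (≤ᵥ-* (1≤ᵥ-binom 0≤a r<q q<p 1≤a-r) (1≤ᵥ-binom 0≤b (ℕP.∸-monoʳ-< 0<r (ℕP.<⇒≤ r<q)) q<p 1≤b-[q-r]))
           (p∣⇒1≤ᵥ (p∣centralBinom p≡1+q))
      where
      1≤b-[q-r] : 1 ≤ᵥ ((- 1ℚ - a) - fromℕ (q ∸ r))
      1≤b-[q-r] = subst (1 ≤ᵥ_) (sym (-1-a-[q-r]≡-[a-r]-p a p≡1+q (ℕP.<⇒≤ r<q))) (≤ᵥ-- (≤ᵥ-neg 1≤a-r) 1≤ᵥp)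

theorem3p1 : (p : ℕ) → Prime p → p ≢ 2 → (a m : ℚ) → InZp p a → InZp p m →
    ¬ CongMod p 1 a 0ℚ → ¬ CongMod p 1 a (- 1ℚ) → ¬ CongMod p 1 m 0ℚ →
    let S0 = sumTo p (λ k → c a k ÷' (m ^' k))
        S1 = sumTo p (λ k → fromℕ k * c a k ÷' (m ^' k))
        S2 = sumTo p (λ k → fromℕ k ^' 2 * c a k ÷' (m ^' k))
        S3 = sumTo p (λ k → fromℕ k ^' 3 * c a k ÷' (m ^' k))
        T = sumTo (p ∸ 1) (λ k → c a k ÷' ((m ^' k) * fromℕ (suc k)))
        A = a * (a + 1ℚ)
        M4 = m - fromℕ 4
    in CongMod p 3 (M4 ÷' fromℕ 2 * S2) (S1 - fromℕ 2 * A * S0 + A * T)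
     × CongMod p 3 (M4 ÷' fromℕ 2 * S3) (fromℕ 3 * S2 - (fromℕ 2 * A - 1ℚ) * S1 - A * S0)
     × (¬ CongMod p 1 m (fromℕ 4) →
         CongMod p 3 S3
           (((fromℕ 2 - fromℕ 4 * A) * M4 + fromℕ 12) ÷' (M4 ^' 2) * S1
            - fromℕ 2 * A * (m + fromℕ 8) ÷' (M4 ^' 2) * S0
            + fromℕ 12 * A ÷' (M4 ^' 2) * T))
theorem3p1 zero p-prime = contradiction p-prime ¬prime[0]
theorem3p1 (suc q) p-prime _ a m a∈ℤₚ _ a≢0 a≢-1 m≢0 =
  ≤ᵥ⇒CongMod (L₁ q) (R₁ q) 3≤D₁ , ≤ᵥ⇒CongMod (L₂ q) (R₂ q) 3≤D₂ , λ m≢4 → ≤ᵥ⇒CongMod (S₃ (suc q)) (R₃ q) (3≤D₃ m≢4)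
  where
  open Valuation (suc q) p-prime
  A : ℚ
  A = a * (a + 1ℚ)
  m≢0′ : m ≢ 0ℚ
  m≢0′ m≡0 = ¬CongMod⇒≢ m 0ℚ m≢0 (trans (+-identityʳ m) m≡0)
  open Moments A m m≢0′ (c a) (c-suc a)
  0≤a : 0 ≤ᵥ a
  0≤a = InZp⇒0≤ᵥ {a} a∈ℤₚ
  0≤A : 0 ≤ᵥ A
  0≤A = ≤ᵥ-* 0≤a (≤ᵥ-+ 0≤a (0≤ᵥ-fromℕ 1))
  0≤2Q+1 : 0 ≤ᵥ (fromℕ 2 * fromℕ q + 1ℚ)
  0≤2Q+1 = ≤ᵥ-+ (≤ᵥ-* (0≤ᵥ-fromℕ 2) (0≤ᵥ-fromℕ q)) (0≤ᵥ-fromℕ 1)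
  3≤u : 3 ≤ᵥ u q
  3≤u = ≤ᵥ-* (3≤ᵥ-c {a} {q} refl a∈ℤₚ a≢0 a≢-1)
             (0≤ᵥ-inv-^ (subst (λ x → 0 ≤ᵥ inv x) (+-identityʳ m) (¬CongMod⇒0≤ᵥinv m 0ℚ m≢0)) q)
  3≤D₁ : 3 ≤ᵥ (L₁ q - R₁ q)
  3≤D₁ = subst (3 ≤ᵥ_) (sym (defect₁ q))
    (≤ᵥ-* (≤ᵥ-- (≤ᵥ-* (0≤ᵥ-fromℕ 2) 0≤A) (≤ᵥ-* 0≤2Q+1 (0≤ᵥ-fromℕ q))) 3≤u)
  3≤D₂ : 3 ≤ᵥ (L₂ q - R₂ q)
  3≤D₂ = subst (3 ≤ᵥ_) (sym (defect₂ q))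
    (≤ᵥ-* (≤ᵥ-neg (≤ᵥ-* 0≤2Q+1 (≤ᵥ-- (≤ᵥ-* (0≤ᵥ-fromℕ q) (≤ᵥ-+ (0≤ᵥ-fromℕ q) (0≤ᵥ-fromℕ 1))) 0≤A))) 3≤u)
  3≤D₃ : ¬ CongMod (suc q) 1 m (fromℕ 4) → 3 ≤ᵥ (S₃ (suc q) - R₃ q)
  3≤D₃ m≢4 = subst (3 ≤ᵥ_) (sym (defect₃ q (*-inv (¬CongMod⇒≢ m (fromℕ 4) m≢4))))
    (≤ᵥ-+ (≤ᵥ-* (≤ᵥ-* (0≤ᵥ-fromℕ 2) 0≤J) 3≤D₂) (≤ᵥ-* (≤ᵥ-* (0≤ᵥ-fromℕ 12) (≤ᵥ-* 0≤J 0≤J)) 3≤D₁))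
    where
    0≤J : 0 ≤ᵥ inv (m - fromℕ 4)
    0≤J = ¬CongMod⇒0≤ᵥinv m (fromℕ 4) m≢4
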